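{- For integers $0\le k\le n$, let $\left\langle n\atop k\right\rangle$ denote the number of $n$-tilings (tilings of a board of any length using exactly $n$ tiles, each a square or a $(1,1)$-fence) that contain exactly $k$ fences, with $\left\langle 0\atop 0\right\rangle=1$. Let $R(n,k)$ be the coefficient of $x^n$ in the power series expansion of $\dfrac{1}{1-x^2}\left(\dfrac{x}{1-x}\right)^k$ (the $(n,k)$th entry of the Riordan array $(1/(1-x^2),x/(1-x))$). Then for all $0\le k\le n$, \[ \left\langle n\atop k\right\rangle=R(n,n-k). \]
   Context: A board of length $L$ is a $1\times L$ row of unit cells. A square is a $1\times1$ tile. A $(1,1)$-fence is a tile consisting of two $1\times1$ posts separated by a one-cell gap; placed on a board its posts occupy cells $i$ and $i+2$, and the gap cell must be covered by another tile. A tiling covers every cell exactly once. -}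

module Defs where

open import Data.Nat using (ℕ; zero; suc; _+_; _*_; _∸_; _<_; _≟_)
open import Data.Nat.Properties using ()
open import Data.Bool using (Bool; true; false; if_then_else_)
open import Data.List using (List; []; _∷_; length; concatMap; upTo; map; filter)
open import Data.Nat.ListAction using (sum)
open import Data.List.Relation.Unary.All using (All)
open import Data.List.Relation.Unary.Linked using (Linked)
open import Data.Product using (Σ; _×_; _,_; proj₁; proj₂)
open import Relation.Binary.PropositionalEquality using (_≡_)

data Tile : Set where
  square fence : Tile

-- A placed tile: its kind and the (0-based) cell of its leftmost cell.
Placement : Set
Placement = Tile × ℕ

cellsOf : Placement → List ℕ
cellsOf (square , i) = i ∷ []
cellsOf (fence  , i) = i ∷ (i + 2) ∷ []

cover : List Placement → List ℕ
cover ps = concatMap cellsOf ps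

-- Strictly increasing start positions: the list is a canonical
-- (duplicate-free, ordered) representation of a set of placed tiles.
_<ₚ_ : Placement → Placement → Set
p <ₚ q = proj₂ p < proj₂ q

IsTiling : ℕ → List Placement → Set
IsTiling L ps =
  Linked _<ₚ_ ps
  × All (λ c → c < L) (cover ps)
  × All (λ c → length (filter (_≟ c) (cover ps)) ≡ 1) (upTo L)

isFence : Placement → Bool
isFence (square , _) = false
isFence (fence  , _) = true

fenceCount : List Placement → ℕ
fenceCount ps = length (Data.List.filterᵇ isFence ps)

NTiling : ℕ → ℕ → Set
NTiling n k =
  Σ ℕ λ L → Σ (List Placement) λ ps →
    IsTiling L ps × length ps ≡ n × fenceCount ps ≡ k

Series : Set
Series = ℕ → ℕ

_⊛_ : Series → Series → Series
(f ⊛ g) n = sum (map (λ i → f i * g (n ∸ i)) (upTo (suc n)))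

oneS : Series
oneS zero    = 1
oneS (suc _) = 0

_^S_ : Series → ℕ → Series
f ^S zero  = oneS
f ^S suc k = f ⊛ (f ^S k)

invOneMinusX² : Series
invOneMinusX² zero          = 1
invOneMinusX² (suc zero)    = 0
invOneMinusX² (suc (suc n)) = invOneMinusX² n

xOverOneMinusX : Series
xOverOneMinusX zero    = 0
xOverOneMinusX (suc _) = 1

R : ℕ → ℕ → ℕ
R n k = (invOneMinusX² ⊛ (xOverOneMinusX ^S k)) n

-- Read left to right, a tiling is forced into three kinds of blocks: the gap of
-- a fence at i must be covered at once, either by a square at i+1 or by the
-- left post of a second fence at i+1, whose own gap i+2 is the first fence's
-- right post.  So n-tilings with k fences are words in the blocks
-- "square", "fence + square" and "fence + fence", and their number obeys a
-- three-term recurrence.  On the Riordan side the factor x/(1-x) gives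
-- R(n+1,m+1) = R(n,m) + R(n,m+1), and two applications of it reproduce the
-- three-term recurrence along the diagonal m = n - k.
module Submission where

open import Defs
open import Data.Nat using (ℕ; _≤_; _∸_)
open import Data.Fin using (Fin)
open import Function.Bundles using (_↔_)

open import Data.Empty using (⊥-elim)
open import Data.Fin using (zero)
open import Data.Fin.Properties using (+↔⊎)
open import Data.List using (List; []; _∷_; [_]; length; filter; map; upTo; applyUpTo)
open import Data.List.Membership.Propositional using (_∈_)
open import Data.List.Properties using (map-applyUpTo; map-upTo; filter-accept; filter-reject; ∷-injectiveʳ)
open import Data.List.Relation.Unary.All as All using (All; []; _∷_)
open import Data.List.Relation.Unary.All.Properties using (applyUpTo⁺₁; applyUpTo⁻)
open import Data.List.Relation.Unary.Any using (here; there)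
open import Data.List.Relation.Unary.Linked as Linked using (Linked; []; [-]; _∷_)
open import Data.List.Relation.Unary.Linked.Properties using (Linked⇒All)
open import Data.Nat using (zero; suc; _+_; _*_; _<_; _≟_; _<?_; z≤n; s≤s; z<s)
open import Data.Nat.ListAction using (sum)
open import Data.Nat.Properties
open import Algebra.Properties.CommutativeSemigroup +-commutativeSemigroup using (interchange; x∙yz≈y∙xz)
open import Data.Product using (Σ; ∃; _×_; _,_; proj₁; proj₂)
open import Data.Sum using (_⊎_; inj₁; inj₂; [_,_]′)
open import Data.Sum.Function.Propositional using (_⊎-cong_)
open import Function using (_∘_)
open import Function.Bundles using (mk↔ₛ′)
open import Function.Properties.Inverse using (↔-trans)
open import Relation.Binary.PropositionalEquality hiding ([_])
open ≡-Reasoning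
open import Relation.Nullary using (¬_; yes; no)

-- The Riordan array

⊛-zero : ∀ f g → (f ⊛ g) 0 ≡ f 0 * g 0
⊛-zero f g = +-identityʳ (f 0 * g 0)

⊛-suc : ∀ f g n → (f ⊛ g) (suc n) ≡ f 0 * g (suc n) + ((f ∘ suc) ⊛ g) n
⊛-suc f g n = cong (λ xs → f 0 * g (suc n) + sum xs) (begin
    map h (applyUpTo suc (suc n))  ≡⟨ map-applyUpTo suc h (suc n) ⟩
    applyUpTo (h ∘ suc) (suc n)    ≡⟨ map-upTo (h ∘ suc) (suc n) ⟨
    map (h ∘ suc) (upTo (suc n))   ∎)
  where
  h : ℕ → ℕ
  h i = f i * g (suc n ∸ i)

⊛-identityʳ : ∀ f n → (f ⊛ oneS) n ≡ f n
⊛-identityʳ f zero    = trans (⊛-zero f oneS) (*-identityʳ (f 0))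
⊛-identityʳ f (suc n) =
  trans (⊛-suc f oneS n) (cong₂ _+_ (*-zeroʳ (f 0)) (⊛-identityʳ (f ∘ suc) n))

-- As series: g = x a / (1 - x) implies f g = x (f a) / (1 - x).
⊛-partialSums : ∀ {a g : Series} → g 0 ≡ 0 → (∀ j → g (suc j) ≡ a j + g j) →
                ∀ f n → (f ⊛ g) (suc n) ≡ (f ⊛ a) n + (f ⊛ g) n
⊛-partialSums {a} {g} g₀ g-suc f zero = begin
    (f ⊛ g) 1                      ≡⟨ ⊛-suc f g 0 ⟩
    f 0 * g 1 + ((f ∘ suc) ⊛ g) 0  ≡⟨ cong₂ _+_ (cong (f 0 *_) (g-suc 0)) tail₀ ⟩
    f 0 * (a 0 + g 0) + 0          ≡⟨ +-identityʳ _ ⟩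
    f 0 * (a 0 + g 0)              ≡⟨ *-distribˡ-+ (f 0) (a 0) (g 0) ⟩
    f 0 * a 0 + f 0 * g 0          ≡⟨ cong₂ _+_ (⊛-zero f a) (⊛-zero f g) ⟨
    (f ⊛ a) 0 + (f ⊛ g) 0          ∎
  where
  tail₀ : ((f ∘ suc) ⊛ g) 0 ≡ 0
  tail₀ = trans (⊛-zero (f ∘ suc) g) (trans (cong (f 1 *_) g₀) (*-zeroʳ (f 1)))
⊛-partialSums {a} {g} g₀ g-suc f (suc n) = begin
    (f ⊛ g) (2 + n)                                    ≡⟨ ⊛-suc f g (suc n) ⟩
    f 0 * g (2 + n) + ((f ∘ suc) ⊛ g) (suc n)          ≡⟨ cong₂ _+_ (cong (f 0 *_) (g-suc (suc n)))
                                                                    (⊛-partialSums {a} {g} g₀ g-suc (f ∘ suc) n) ⟩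
    f 0 * (a (suc n) + g (suc n)) + (a′ + g′)          ≡⟨ cong (_+ (a′ + g′)) (*-distribˡ-+ (f 0) (a (suc n)) (g (suc n))) ⟩
    (f 0 * a (suc n) + f 0 * g (suc n)) + (a′ + g′)    ≡⟨ interchange (f 0 * a (suc n)) (f 0 * g (suc n)) a′ g′ ⟩
    (f 0 * a (suc n) + a′) + (f 0 * g (suc n) + g′)    ≡⟨ cong₂ _+_ (⊛-suc f a n) (⊛-suc f g n) ⟨
    (f ⊛ a) (suc n) + (f ⊛ g) (suc n)                  ∎
  where
  a′ = ((f ∘ suc) ⊛ a) n
  g′ = ((f ∘ suc) ⊛ g) n

xOverOneMinusX-⊛-suc : ∀ a j → (xOverOneMinusX ⊛ a) (suc j) ≡ a j + (xOverOneMinusX ⊛ a) j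
xOverOneMinusX-⊛-suc a zero    = +-identityʳ _
xOverOneMinusX-⊛-suc a (suc j) = begin
    (xOverOneMinusX ⊛ a) (2 + j)             ≡⟨ ⊛-suc xOverOneMinusX a (suc j) ⟩
    ((xOverOneMinusX ∘ suc) ⊛ a) (suc j)     ≡⟨ ⊛-suc (xOverOneMinusX ∘ suc) a j ⟩
    1 * a (suc j) + ((xOverOneMinusX ∘ suc) ⊛ a) j
      ≡⟨ cong₂ _+_ (*-identityˡ (a (suc j))) (sym (⊛-suc xOverOneMinusX a j)) ⟩
    a (suc j) + (xOverOneMinusX ⊛ a) (suc j) ∎

R-suc : ∀ n m → R (suc n) (suc m) ≡ R n m + R n (suc m)
R-suc n m = ⊛-partialSums {xOverOneMinusX ^S m} {xOverOneMinusX ^S suc m}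
  refl (xOverOneMinusX-⊛-suc (xOverOneMinusX ^S m)) invOneMinusX² n

R-vanishes : ∀ {n m} → n < m → R n m ≡ 0
R-vanishes {zero}  {suc m} _         = refl
R-vanishes {suc n} {suc m} (s≤s n<m) =
  trans (R-suc n m) (cong₂ _+_ (R-vanishes n<m) (R-vanishes (m<n⇒m<1+n n<m)))

R-diagonal : ∀ n → R n n ≡ 1
R-diagonal zero    = refl
R-diagonal (suc n) = trans (R-suc n n) (cong₂ _+_ (R-diagonal n) (R-vanishes (n<1+n n)))

-- Counting block words

-- A tiling, read left to right, as a word in three blocks: a square, a fence
-- whose gap holds a square (3 cells), and two fences at i and i+1 (4 cells).
-- The indices are the number of tiles and of fences.
data Blocks : ℕ → ℕ → Set where
  nil : Blocks 0 0
  sq  : ∀ {n k} → Blocks n k → Blocks (suc n) k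
  fs  : ∀ {n k} → Blocks n k → Blocks (2 + n) (suc k)
  ff  : ∀ {n k} → Blocks n k → Blocks (2 + n) (2 + k)

tilingCount : ℕ → ℕ → ℕ
tilingCount zero          zero          = 1
tilingCount zero          (suc k)       = 0
tilingCount 1             k             = tilingCount 0 k
tilingCount (suc (suc n)) zero          = tilingCount (suc n) 0
tilingCount (suc (suc n)) 1             = tilingCount (suc n) 1 + tilingCount n 0
tilingCount (suc (suc n)) (suc (suc k)) =
  tilingCount (suc n) (2 + k) + (tilingCount n (suc k) + tilingCount n k)

Fin↔Blocks : ∀ n k → Fin (tilingCount n k) ↔ Blocks n k
Fin↔Blocks zero zero = mk↔ₛ′ (λ _ → nil) (λ _ → zero) (λ { nil → refl }) (λ { zero → refl })
Fin↔Blocks zero (suc k) = mk↔ₛ′ (λ ()) (λ ()) (λ ()) (λ ())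
Fin↔Blocks 1 k =
  ↔-trans (Fin↔Blocks 0 k) (mk↔ₛ′ sq (λ { (sq b) → b }) (λ { (sq b) → refl }) (λ _ → refl))
Fin↔Blocks (suc (suc n)) zero =
  ↔-trans (Fin↔Blocks (suc n) 0) (mk↔ₛ′ sq (λ { (sq b) → b }) (λ { (sq b) → refl }) (λ _ → refl))
Fin↔Blocks (suc (suc n)) 1 =
  ↔-trans +↔⊎ (↔-trans (Fin↔Blocks (suc n) 1 ⊎-cong Fin↔Blocks n 0) (mk↔ₛ′ to from
    (λ { (sq b) → refl ; (fs b) → refl })
    (λ { (inj₁ _) → refl ; (inj₂ _) → refl })))
  where
  to : Blocks (suc n) 1 ⊎ Blocks n 0 → Blocks (2 + n) 1
  to (inj₁ b) = sq b
  to (inj₂ b) = fs b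
  from : Blocks (2 + n) 1 → Blocks (suc n) 1 ⊎ Blocks n 0
  from (sq b) = inj₁ b
  from (fs b) = inj₂ b
Fin↔Blocks (suc (suc n)) (suc (suc k)) =
  ↔-trans +↔⊎ (↔-trans (Fin↔Blocks (suc n) (2 + k) ⊎-cong
                          ↔-trans +↔⊎ (Fin↔Blocks n (suc k) ⊎-cong Fin↔Blocks n k))
    (mk↔ₛ′ to from
      (λ { (sq b) → refl ; (fs b) → refl ; (ff b) → refl })
      (λ { (inj₁ _) → refl ; (inj₂ (inj₁ _)) → refl ; (inj₂ (inj₂ _)) → refl })))
  where
  to : Blocks (suc n) (2 + k) ⊎ (Blocks n (suc k) ⊎ Blocks n k) → Blocks (2 + n) (2 + k)
  to (inj₁ b)        = sq b
  to (inj₂ (inj₁ b)) = fs b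
  to (inj₂ (inj₂ b)) = ff b
  from : Blocks (2 + n) (2 + k) → Blocks (suc n) (2 + k) ⊎ (Blocks n (suc k) ⊎ Blocks n k)
  from (sq b) = inj₁ b
  from (fs b) = inj₂ (inj₁ b)
  from (ff b) = inj₂ (inj₂ b)

tilingCount-vanishes : ∀ {n k} → n < k → tilingCount n k ≡ 0
tilingCount-vanishes {zero}        {suc k}       _ = refl
tilingCount-vanishes {1}           {suc k}       _ = refl
tilingCount-vanishes {suc (suc n)} {suc (suc k)} (s≤s (s≤s n<k)) =
  cong₂ _+_ (tilingCount-vanishes (s≤s (m<n⇒m<1+n n<k)))
            (cong₂ _+_ (tilingCount-vanishes (m<n⇒m<1+n n<k)) (tilingCount-vanishes n<k))

∸-suc : ∀ {k n} → k < n → n ∸ k ≡ suc (n ∸ suc k)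
∸-suc {k} {n} k<n = begin
    n ∸ k                    ≡⟨ cong (_∸ k) (m+[n∸m]≡n k<n) ⟨
    suc k + (n ∸ suc k) ∸ k  ≡⟨ cong (_∸ k) (+-suc k (n ∸ suc k)) ⟨
    k + suc (n ∸ suc k) ∸ k  ≡⟨ m+n∸m≡n k (suc (n ∸ suc k)) ⟩
    suc (n ∸ suc k)          ∎

tilingCount-diagonal : ∀ n → tilingCount n n ≡ R n 0
tilingCount-diagonal zero          = refl
tilingCount-diagonal 1             = refl
tilingCount-diagonal (suc (suc n)) = begin
    tilingCount (suc n) (2 + n) + (tilingCount n (suc n) + tilingCount n n)
      ≡⟨ cong₂ (λ x y → x + (y + tilingCount n n)) (tilingCount-vanishes (n<1+n (suc n)))
                                                     (tilingCount-vanishes (n<1+n n)) ⟩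
    tilingCount n n  ≡⟨ tilingCount-diagonal n ⟩
    R n 0            ≡⟨ ⊛-identityʳ invOneMinusX² n ⟩
    invOneMinusX² n  ≡⟨ ⊛-identityʳ invOneMinusX² (2 + n) ⟨
    R (2 + n) 0      ∎

R-threeTerm : ∀ {n k} → k < n →
              R (2 + n) (n ∸ k) ≡ R (suc n) (n ∸ suc k) + (R n (n ∸ suc k) + R n (n ∸ k))
R-threeTerm {n} {k} k<n = begin
    R (2 + n) (n ∸ k)                    ≡⟨ cong (R (2 + n)) (∸-suc k<n) ⟩
    R (2 + n) (suc j)                    ≡⟨ R-suc (suc n) j ⟩
    R (suc n) j + R (suc n) (suc j)      ≡⟨ cong (R (suc n) j +_) (R-suc n j) ⟩
    R (suc n) j + (R n j + R n (suc j))  ≡⟨ cong (λ i → R (suc n) j + (R n j + R n i)) (∸-suc k<n) ⟨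
    R (suc n) j + (R n j + R n (n ∸ k))  ∎
  where
  j = n ∸ suc k

tilingCount≡R : ∀ n k → k ≤ n → tilingCount n k ≡ R n (n ∸ k)
tilingCount≡R zero          zero          _ = refl
tilingCount≡R 1             zero          _ = refl
tilingCount≡R 1             1             _ = refl
tilingCount≡R 1             (suc (suc k)) (s≤s ())
tilingCount≡R (suc (suc n)) zero          _ =
  trans (tilingCount≡R (suc n) 0 z≤n) (trans (R-diagonal (suc n)) (sym (R-diagonal (2 + n))))
tilingCount≡R (suc (suc n)) 1             _ = begin
    tilingCount (suc n) 1 + tilingCount n 0  ≡⟨ cong₂ _+_ (tilingCount≡R (suc n) 1 (s≤s z≤n)) (tilingCount≡R n 0 z≤n) ⟩
    R (suc n) n + R n n                      ≡⟨ cong (R (suc n) n +_) (trans (R-diagonal n) (sym (R-diagonal (suc n)))) ⟩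
    R (suc n) n + R (suc n) (suc n)          ≡⟨ R-suc (suc n) n ⟨
    R (2 + n) (suc n)                        ∎
tilingCount≡R (suc (suc n)) (suc (suc k)) (s≤s (s≤s k≤n)) =
  [ (λ k<n → trans (cong₂ _+_ (tilingCount≡R (suc n) (2 + k) (s≤s k<n))
                              (cong₂ _+_ (tilingCount≡R n (suc k) k<n) (tilingCount≡R n k k≤n)))
                   (sym (R-threeTerm k<n)))
  , (λ { refl → trans (tilingCount-diagonal (2 + n)) (cong (R (2 + n)) (sym (n∸n≡0 n))) })
  ]′ (m≤n⇒m<n∨m≡n k≤n)

-- Multisets of cells

multiplicity : ℕ → List ℕ → ℕ
multiplicity c xs = length (filter (_≟ c) xs)

infix 4 _≋_
record _≋_ (xs ys : List ℕ) : Set where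
  constructor ≋⁺
  field ≋⁻ : ∀ c → multiplicity c xs ≡ multiplicity c ys
open _≋_

multiplicity-∷ : ∀ c x xs → multiplicity c (x ∷ xs) ≡ multiplicity c [ x ] + multiplicity c xs
multiplicity-∷ c x xs with x ≟ c
... | yes x≡c = trans (cong length (filter-accept (_≟ c) x≡c))
                      (cong (_+ multiplicity c xs) (sym (cong length (filter-accept (_≟ c) {xs = []} x≡c))))
... | no  x≢c = trans (cong length (filter-reject (_≟ c) x≢c))
                      (cong (_+ multiplicity c xs) (sym (cong length (filter-reject (_≟ c) {xs = []} x≢c))))

multiplicity-∈ : ∀ {c xs} → c ∈ xs → 0 < multiplicity c xs
multiplicity-∈ {c} (here refl)       = subst (0 <_) (sym (cong length (filter-accept (_≟ c) refl))) (s≤s z≤n)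
multiplicity-∈ {c} (there {x} {xs} c∈xs) =
  subst (0 <_) (sym (multiplicity-∷ c x xs)) (≤-trans (multiplicity-∈ c∈xs) (m≤n+m _ _))

multiplicity-All : ∀ {P : ℕ → Set} {c xs} → All P xs → 0 < multiplicity c xs → P c
multiplicity-All {c = c} (_∷_ {x} {xs} px pxs) pos with x ≟ c
... | yes refl = px
... | no  x≢c  = multiplicity-All pxs (subst (0 <_) (cong length (filter-reject (_≟ c) x≢c)) pos)

multiplicity-¬All : ∀ {P : ℕ → Set} {c xs} → All P xs → ¬ P c → multiplicity c xs ≡ 0
multiplicity-¬All {c = c} {xs} pxs ¬pc with multiplicity c xs in eq
... | zero  = refl
... | suc _ = ⊥-elim (¬pc (multiplicity-All pxs (subst (0 <_) (sym eq) (s≤s z≤n))))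

≋-All : ∀ {P : ℕ → Set} {xs ys} → xs ≋ ys → All P ys → All P xs
≋-All xs≋ys pys = All.tabulate λ {c} c∈xs →
  multiplicity-All pys (subst (0 <_) (≋⁻ xs≋ys c) (multiplicity-∈ c∈xs))

≋-sym : ∀ {xs ys} → xs ≋ ys → ys ≋ xs
≋-sym xs≋ys = ≋⁺ λ c → sym (≋⁻ xs≋ys c)

≋-trans : ∀ {xs ys zs} → xs ≋ ys → ys ≋ zs → xs ≋ zs
≋-trans xs≋ys ys≋zs = ≋⁺ λ c → trans (≋⁻ xs≋ys c) (≋⁻ ys≋zs c)

≋-∷ : ∀ {x y xs ys} → x ≡ y → xs ≋ ys → x ∷ xs ≋ y ∷ ys
≋-∷ {x} {xs = xs} {ys} refl xs≋ys = ≋⁺ λ c → begin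
    multiplicity c (x ∷ xs)                  ≡⟨ multiplicity-∷ c x xs ⟩
    multiplicity c [ x ] + multiplicity c xs ≡⟨ cong (multiplicity c [ x ] +_) (≋⁻ xs≋ys c) ⟩
    multiplicity c [ x ] + multiplicity c ys ≡⟨ multiplicity-∷ c x ys ⟨
    multiplicity c (x ∷ ys)                  ∎

≋-swap : ∀ x y xs → x ∷ y ∷ xs ≋ y ∷ x ∷ xs
≋-swap x y xs = ≋⁺ λ c → begin
    multiplicity c (x ∷ y ∷ xs)                               ≡⟨ multiplicity-∷ c x (y ∷ xs) ⟩
    multiplicity c [ x ] + multiplicity c (y ∷ xs)            ≡⟨ cong (multiplicity c [ x ] +_) (multiplicity-∷ c y xs) ⟩
    multiplicity c [ x ] + (multiplicity c [ y ] + multiplicity c xs)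
      ≡⟨ x∙yz≈y∙xz (multiplicity c [ x ]) (multiplicity c [ y ]) (multiplicity c xs) ⟩
    multiplicity c [ y ] + (multiplicity c [ x ] + multiplicity c xs)
      ≡⟨ cong (multiplicity c [ y ] +_) (multiplicity-∷ c x xs) ⟨
    multiplicity c [ y ] + multiplicity c (x ∷ xs)            ≡⟨ multiplicity-∷ c y (x ∷ xs) ⟨
    multiplicity c (y ∷ x ∷ xs)                               ∎

≋-cancel : ∀ {x y xs ys} → x ≡ y → x ∷ xs ≋ y ∷ ys → xs ≋ ys
≋-cancel {x} {xs = xs} {ys} refl eq = ≋⁺ λ c → +-cancelˡ-≡ (multiplicity c [ x ]) _ _
  (trans (sym (multiplicity-∷ c x xs)) (trans (≋⁻ eq c) (multiplicity-∷ c x ys)))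

¬∷≋[] : ∀ {x xs} → ¬ (x ∷ xs ≋ [])
¬∷≋[] {x} {xs} eq = <-irrefl refl (subst (0 <_) (≋⁻ eq x) (multiplicity-∈ {xs = x ∷ xs} (here refl)))

¬[]≋∷ : ∀ {x xs} → ¬ ([] ≋ x ∷ xs)
¬[]≋∷ eq = ¬∷≋[] (≋-sym eq)

interval : ℕ → ℕ → List ℕ
interval o zero    = []
interval o (suc m) = o ∷ interval (suc o) m

interval-≥ : ∀ {b o} m → b ≤ o → All (b ≤_) (interval o m)
interval-≥ zero    b≤o = []
interval-≥ (suc m) b≤o = b≤o ∷ interval-≥ m (m≤n⇒m≤1+n b≤o)

interval-< : ∀ o m → All (_< o + m) (interval o m)
interval-< o zero    = []
interval-< o (suc m) =
  m<m+n o z<s ∷ subst (λ b → All (_< b) (interval (suc o) m)) (sym (+-suc o m)) (interval-< (suc o) m)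

multiplicity-interval : ∀ {o c} m → o ≤ c → c < o + m → multiplicity c (interval o m) ≡ 1
multiplicity-interval {o} {c} zero o≤c c<o+0 = ⊥-elim (<⇒≱ c<o+0 (subst (_≤ c) (sym (+-identityʳ o)) o≤c))
multiplicity-interval {o} {c} (suc m) o≤c c<o+m with o ≟ c
... | yes refl = trans (cong length (filter-accept (_≟ o) refl))
                       (cong suc (multiplicity-¬All (interval-≥ m ≤-refl) (<⇒≱ (n<1+n o))))
... | no  o≢c  = trans (cong length (filter-reject (_≟ c) o≢c))
                       (multiplicity-interval m (≤∧≢⇒< o≤c o≢c) (subst (c <_) (+-suc o m) c<o+m))

-- Tilings as block words

placements : ∀ {n k} → ℕ → Blocks n k → List Placement
placements o nil    = []
placements o (sq b) = (square , o) ∷ placements (suc o) b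
placements o (fs b) = (fence , o) ∷ (square , suc o) ∷ placements (3 + o) b
placements o (ff b) = (fence , o) ∷ (fence , suc o) ∷ placements (4 + o) b

width : ∀ {n k} → Blocks n k → ℕ
width nil    = 0
width (sq b) = 1 + width b
width (fs b) = 3 + width b
width (ff b) = 4 + width b

length-placements : ∀ {n k} o (b : Blocks n k) → length (placements o b) ≡ n
length-placements o nil    = refl
length-placements o (sq b) = cong suc (length-placements (suc o) b)
length-placements o (fs b) = cong (2 +_) (length-placements (3 + o) b)
length-placements o (ff b) = cong (2 +_) (length-placements (4 + o) b)

fenceCount-placements : ∀ {n k} o (b : Blocks n k) → fenceCount (placements o b) ≡ k
fenceCount-placements o nil    = refl
fenceCount-placements o (sq b) = fenceCount-placements (suc o) b
fenceCount-placements o (fs b) = cong suc (fenceCount-placements (3 + o) b)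
fenceCount-placements o (ff b) = cong (2 +_) (fenceCount-placements (4 + o) b)

placements-injective : ∀ {o n k} {b b′ : Blocks n k} → placements o b ≡ placements o b′ → b ≡ b′
placements-injective {b = nil}  {nil}   _  = refl
placements-injective {b = sq b} {sq b′} eq = cong sq (placements-injective (∷-injectiveʳ eq))
placements-injective {b = fs b} {fs b′} eq = cong fs (placements-injective (∷-injectiveʳ (∷-injectiveʳ eq)))
placements-injective {b = ff b} {ff b′} eq = cong ff (placements-injective (∷-injectiveʳ (∷-injectiveʳ eq)))
placements-injective {b = sq _} {fs _}  ()
placements-injective {b = sq _} {ff _}  ()
placements-injective {b = fs _} {sq _}  ()
placements-injective {b = fs _} {ff _}  ()
placements-injective {b = ff _} {sq _}  ()
placements-injective {b = ff _} {fs _}  ()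

linked-placements : ∀ {n k} o (b : Blocks n k) → Linked _<ₚ_ (placements o b)
linked-after : ∀ {n k} p o (b : Blocks n k) → proj₂ p < o → Linked _<ₚ_ (p ∷ placements o b)

linked-placements o nil    = []
linked-placements o (sq b) = linked-after _ (suc o) b (n<1+n o)
linked-placements o (fs b) = n<1+n o ∷ linked-after _ (3 + o) b (m<n+m (suc o) {2} z<s)
linked-placements o (ff b) = n<1+n o ∷ linked-after _ (4 + o) b (m<n+m (suc o) {3} z<s)

linked-after p o nil    p<o = [-]
linked-after p o (sq b) p<o = p<o ∷ linked-placements o (sq b)
linked-after p o (fs b) p<o = p<o ∷ linked-placements o (fs b)
linked-after p o (ff b) p<o = p<o ∷ linked-placements o (ff b)

cover-placements : ∀ {n k} o (b : Blocks n k) → cover (placements o b) ≋ interval o (width b)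
cover-placements o nil    = ≋⁺ λ _ → refl
cover-placements o (sq b) = ≋-∷ refl (cover-placements (suc o) b)
cover-placements o (fs b) =
  ≋-∷ refl (≋-trans (≋-swap (o + 2) (suc o) _) (≋-∷ refl (≋-∷ (+-comm o 2) (cover-placements (3 + o) b))))
cover-placements o (ff b) =
  ≋-∷ refl (≋-trans (≋-swap (o + 2) (suc o) _)
    (≋-∷ refl (≋-∷ (+-comm o 2) (≋-∷ (+-comm (suc o) 2) (cover-placements (4 + o) b)))))

starts-≥-head : ∀ {p ps} → Linked _<ₚ_ (p ∷ ps) → All (λ q → proj₂ p ≤ proj₂ q) (p ∷ ps)
starts-≥-head [-]             = ≤-refl ∷ []
starts-≥-head {p} (p<q ∷ lnk) = ≤-refl ∷ All.map <⇒≤ (Linked⇒All {R = _<ₚ_} <-trans {v = p} p<q lnk)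

cover-≥ : ∀ {b ps} → All (λ q → b ≤ proj₂ q) ps → All (b ≤_) (cover ps)
cover-≥ {ps = []}                 []           = []
cover-≥ {ps = (square , i) ∷ ps} (b≤i ∷ rest) = b≤i ∷ cover-≥ rest
cover-≥ {ps = (fence  , i) ∷ ps} (b≤i ∷ rest) = b≤i ∷ ≤-trans b≤i (m≤m+n i 2) ∷ cover-≥ rest

start-∈-cover : ∀ p ps → proj₂ p ∈ cover (p ∷ ps)
start-∈-cover (square , i) ps = here refl
start-∈-cover (fence  , i) ps = here refl

-- The start of the first tile and o are both the least element of the same multiset.
head-start : ∀ {p ps o ys} → Linked _<ₚ_ (p ∷ ps) → cover (p ∷ ps) ≋ o ∷ ys → All (o ≤_) ys → proj₂ p ≡ o
head-start {p} {ps} lnk eq ys≥o = ≤-antisym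
  (All.lookup (≋-All (≋-sym eq) (cover-≥ (starts-≥-head lnk))) (here refl))
  (All.lookup (≋-All eq (≤-refl ∷ ys≥o)) (start-∈-cover p ps))

room-after-fence : ∀ {o m xs} → o + 2 ∷ xs ≋ interval (suc o) m → 2 ≤ m
room-after-fence {o} {m} eq =
  +-cancelˡ-≤ o 2 m (≤-pred (All.lookup (≋-All eq (interval-< (suc o) m)) (here refl)))

Decomposition : ℕ → ℕ → List Placement → Set
Decomposition o m ps = Σ (Blocks (length ps) (fenceCount ps)) λ b → ps ≡ placements o b × m ≡ width b

decompose : ∀ ps o m → Linked _<ₚ_ ps → cover ps ≋ interval o m → Decomposition o m ps
-- ps tiles the cells o+1 and o+3, o+4, …, o+2+m, the fence at o having taken o and o+2.
decompose-gap : ∀ ps o m → Linked _<ₚ_ ((fence , o) ∷ ps) → cover ps ≋ suc o ∷ interval (3 + o) m →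
                Decomposition o (3 + m) ((fence , o) ∷ ps)

decompose []                  o zero    _   _  = nil , refl , refl
decompose []                  o (suc m) _   eq = ⊥-elim (¬[]≋∷ eq)
decompose ((square , i) ∷ ps) o zero    _   eq = ⊥-elim (¬∷≋[] eq)
decompose ((fence  , i) ∷ ps) o zero    _   eq = ⊥-elim (¬∷≋[] eq)
decompose ((t , i) ∷ ps) o (suc m) lnk eq with head-start lnk eq (interval-≥ m (n≤1+n o))
decompose ((square , .o) ∷ ps) o (suc m) lnk eq | refl
  with decompose ps (suc o) m (Linked.tail lnk) (≋-cancel refl eq)
... | b , ps≡ , m≡ = sq b , cong ((square , o) ∷_) ps≡ , cong suc m≡
decompose ((fence , .o) ∷ ps) o (suc m) lnk eq | refl with room-after-fence (≋-cancel refl eq)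
decompose ((fence , .o) ∷ ps) o (suc (suc (suc m))) lnk eq | refl | s≤s (s≤s z≤n) =
  decompose-gap ps o m lnk
    (≋-cancel (+-comm o 2) (≋-trans (≋-cancel refl eq) (≋-swap (suc o) (2 + o) (interval (3 + o) m))))

decompose-gap []             o m _   eq = ⊥-elim (¬[]≋∷ eq)
decompose-gap ((t , i) ∷ ps) o m lnk eq
  with head-start (Linked.tail lnk) eq (interval-≥ m (m≤n+m (suc o) 2))
decompose-gap ((square , .(suc o)) ∷ ps) o m lnk eq | refl
  with decompose ps (3 + o) m (Linked.tail (Linked.tail lnk)) (≋-cancel refl eq)
... | b , ps≡ , m≡ = fs b , cong (λ qs → (fence , o) ∷ (square , suc o) ∷ qs) ps≡ , cong (3 +_) m≡
decompose-gap ((fence , .(suc o)) ∷ ps) o zero lnk eq | refl = ⊥-elim (¬∷≋[] (≋-cancel refl eq))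
decompose-gap ((fence , .(suc o)) ∷ ps) o (suc m) lnk eq | refl
  with decompose ps (4 + o) m (Linked.tail (Linked.tail lnk)) (≋-cancel (+-comm (suc o) 2) (≋-cancel refl eq))
... | b , ps≡ , m≡ = ff b , cong (λ qs → (fence , o) ∷ (fence , suc o) ∷ qs) ps≡ , cong (4 +_) m≡

tiling⇒≋ : ∀ {L ps} → IsTiling L ps → cover ps ≋ interval 0 L
tiling⇒≋ {L} {ps} (_ , below , once) = ≋⁺ same
  where
  same : ∀ c → multiplicity c (cover ps) ≡ multiplicity c (interval 0 L)
  same c with c <? L
  ... | yes c<L = trans (applyUpTo⁻ (λ i → i) L once c<L) (sym (multiplicity-interval L z≤n c<L))
  ... | no  c≮L = trans (multiplicity-¬All below c≮L) (sym (multiplicity-¬All (interval-< 0 L) c≮L))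

≋⇒tiling : ∀ {L ps} → Linked _<ₚ_ ps → cover ps ≋ interval 0 L → IsTiling L ps
≋⇒tiling {L} lnk eq = lnk , ≋-All eq (interval-< 0 L) ,
  applyUpTo⁺₁ (λ i → i) L (λ c<L → trans (≋⁻ eq _) (multiplicity-interval L z≤n c<L))

IsTiling-irrelevant : ∀ {L ps} (t t′ : IsTiling L ps) → t ≡ t′
IsTiling-irrelevant (lnk , below , once) (lnk′ , below′ , once′) =
  cong₂ _,_ (Linked.irrelevant <-irrelevant lnk lnk′)
            (cong₂ _,_ (All.irrelevant <-irrelevant below below′) (All.irrelevant ≡-irrelevant once once′))

NTiling-≡ : ∀ {n k L L′ ps ps′} {t : IsTiling L ps × length ps ≡ n × fenceCount ps ≡ k}
              {t′ : IsTiling L′ ps′ × length ps′ ≡ n × fenceCount ps′ ≡ k} →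
            L ≡ L′ → ps ≡ ps′ → _≡_ {A = NTiling n k} (L , ps , t) (L′ , ps′ , t′)
NTiling-≡ {t = til , len , fc} {til′ , len′ , fc′} refl refl =
  cong (λ t → _ , _ , t)
    (cong₂ _,_ (IsTiling-irrelevant til til′) (cong₂ _,_ (≡-irrelevant len len′) (≡-irrelevant fc fc′)))

toNTiling : ∀ {n k} → Blocks n k → NTiling n k
toNTiling b = width b , placements 0 b ,
  ≋⇒tiling (linked-placements 0 b) (cover-placements 0 b) , length-placements 0 b , fenceCount-placements 0 b

toNTiling-surjective : ∀ {n k} (t : NTiling n k) → ∃ λ b → toNTiling b ≡ t
toNTiling-surjective (L , ps , til , refl , refl) with decompose ps 0 L (proj₁ til) (tiling⇒≋ til)
... | b , ps≡ , L≡ = b , NTiling-≡ (sym L≡) (sym ps≡)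

Blocks↔NTiling : ∀ {n k} → Blocks n k ↔ NTiling n k
Blocks↔NTiling = mk↔ₛ′ toNTiling (proj₁ ∘ toNTiling-surjective) (proj₂ ∘ toNTiling-surjective)
  (λ b → placements-injective (cong (proj₁ ∘ proj₂) (proj₂ (toNTiling-surjective (toNTiling b)))))

theorem5p12 : (n k : ℕ) → k ≤ n → Fin (R n (n ∸ k)) ↔ NTiling n k
theorem5p12 n k k≤n =
  subst (λ c → Fin c ↔ NTiling n k) (tilingCount≡R n k k≤n) (↔-trans (Fin↔Blocks n k) Blocks↔NTiling)
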